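{- Let $m\ge 3$, $n\ge 1$ and $t\ge 1$ be integers. If $2(m-2)n^2+t(m-4)^2$ is a prime number, then the system $$a+b=n,\qquad ab=t\,P(m,c)$$ has no solution with $a,b$ positive integers and $c$ an admissible index (a positive integer if $m\in\{3,4\}$, an arbitrary integer if $m>4$).
   Context: For an integer $m\ge 3$, $P(m,c)=\frac{c}{2}\{(m-2)c-(m-4)\}$ denotes the $c$-th $m$-gonal number. So that $c\mapsto P(m,c)$ is injective, $c$ ranges over positive integers when $m=3$ or $m=4$, and over all integers when $m>4$. -}

module Defs where

open import Data.Nat using (ℕ)
open import Data.Integer using (ℤ; +_; _+_; _-_; _*_; _/ℕ_)

-- P(m,c) = c/2 * ((m-2)c - (m-4)), the c-th m-gonal number.
-- The product c * ((m-2)c - (m-4)) is always even, so the (floor)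
-- division by 2 below is exact.
P : ℕ → ℤ → ℤ
P m c = (c * ((+ m - + 2) * c - (+ m - + 4))) /ℕ 2

{-# OPTIONS --safe #-}

-- Put f = 2(m − 2), d = m − 4 and p = f (a + b)² + t d². Clearing the
-- denominator of P, the equation ab = t P(m,c) becomes 4ab = t c (f c − 2d),
-- which says precisely that p = f (a − b)² + t (f c − d)² as well. A prime p > f
-- has essentially one representation by f X² + g Y² once f g ≥ 2: for two of
-- them p divides f (x y' − x' y)(x y' + x' y), while Brahmagupta's identity
-- p² = (f x x' ± g y y')² + f g (x y' ∓ x' y)² bounds each factor by p / √(f g),
-- so the one divisible by p is 0. Hence (a + b)² = (a − b)², i.e. ab = 0.

module Submission where

open import Defs
open import Data.Nat using (ℕ; _≤_; _>_) renaming (_+_ to _+ℕ_)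
open import Data.Integer using (ℤ; +_; _+_; _-_; _*_; ∣_∣) renaming (_>_ to _>ℤ_)
open import Data.Nat.Primality using (Prime)
open import Data.Product using (Σ; _×_)
open import Relation.Nullary using (¬_)
open import Relation.Binary.PropositionalEquality using (_≡_)

open import Data.Integer using (0ℤ; -[1+_]; _/ℕ_; _%ℕ_)
open import Data.Integer.DivMod using (a≡a%ℕn+[a/ℕn]*n; n%ℕd<d)
open import Data.Integer.Tactic.RingSolver using (solve-∀)
import Data.Nat as ℕ
import Data.Nat.Properties as ℕₚ
import Data.Integer.Properties as ℤₚ
open import Data.Nat.Divisibility using (_∣_; ∣⇒≤; m∣m*n)
open import Data.Nat.Primality using (euclidsLemma; prime⇒nonZero)
open import Data.Product using (_,_)
open import Data.Sum using (_⊎_; inj₁; inj₂; [_,_])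
open import Data.Empty using (⊥-elim)
open import Relation.Binary.PropositionalEquality
  using (_≢_; refl; sym; trans; cong; cong₂; subst; module ≡-Reasoning)

1≢z*2 : ∀ z → + 1 ≢ z * + 2
1≢z*2 z eq = 1≢n*2 ∣ z ∣ (trans (cong ∣_∣ eq) (ℤₚ.abs-* z (+ 2)))
  where
  1≢n*2 : ∀ n → 1 ≢ n ℕ.* 2
  1≢n*2 ℕ.zero    ()
  1≢n*2 (ℕ.suc n) ()

parity : ∀ x → x ≡ x /ℕ 2 * + 2 ⊎ x ≡ + 1 + x /ℕ 2 * + 2
parity x with x %ℕ 2 | n%ℕd<d x 2 | a≡a%ℕn+[a/ℕn]*n x 2
... | 0 | _ | eq = inj₁ (trans eq (ℤₚ.+-identityˡ _))
... | 1 | _ | eq = inj₂ eq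
... | ℕ.suc (ℕ.suc _) | ℕ.s≤s (ℕ.s≤s ()) | _

/ℕ2-exact : ∀ x w → x ≡ w * + 2 → x /ℕ 2 * + 2 ≡ x
/ℕ2-exact x w x≡2w with parity x
... | inj₁ even = sym even
... | inj₂ odd  = ⊥-elim (1≢z*2 (w - q) (begin
  + 1                     ≡⟨ cancel q ⟩
  + 1 + q * + 2 - q * + 2 ≡⟨ cong (_- q * + 2) (trans (sym odd) x≡2w) ⟩
  w * + 2 - q * + 2       ≡⟨ factor w q ⟩
  (w - q) * + 2           ∎))
  where
  open ≡-Reasoning
  q = x /ℕ 2
  cancel : ∀ q → + 1 ≡ + 1 + q * + 2 - q * + 2
  cancel = solve-∀
  factor : ∀ w q → w * + 2 - q * + 2 ≡ (w - q) * + 2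
  factor = solve-∀

n*[n-1]-even : ∀ n → Σ ℤ λ w → n * (n - + 1) ≡ w * + 2
n*[n-1]-even n with parity n
... | inj₁ even =
  n /ℕ 2 * (n - + 1) , trans (cong (_* (n - + 1)) even) (reassoc (n /ℕ 2) (n - + 1))
  where
  reassoc : ∀ q r → q * + 2 * r ≡ q * r * + 2
  reassoc = solve-∀
... | inj₂ odd  =
  n * (n /ℕ 2) , trans (cong (λ z → n * (z - + 1)) odd) (cancel n (n /ℕ 2))
  where
  cancel : ∀ n q → n * (+ 1 + q * + 2 - + 1) ≡ n * q * + 2
  cancel = solve-∀

2*P≡ : ∀ m c → + 2 * P m c ≡ c * ((+ m - + 2) * c - (+ m - + 4))
2*P≡ m c with n*[n-1]-even c
... | w , c[c-1]≡2w = trans (ℤₚ.*-comm (+ 2) (P m c)) (/ℕ2-exact _ (M * w + c) (begin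
  c * (M * c - (+ m - + 4))     ≡⟨ expand (+ m) c ⟩
  M * (c * (c - + 1)) + c * + 2 ≡⟨ cong (λ z → M * z + c * + 2) c[c-1]≡2w ⟩
  M * (w * + 2) + c * + 2       ≡⟨ collect M w c ⟩
  (M * w + c) * + 2             ∎))
  where
  open ≡-Reasoning
  M = + m - + 2
  expand : ∀ X c → c * ((X - + 2) * c - (X - + 4)) ≡ (X - + 2) * (c * (c - + 1)) + c * + 2
  expand = solve-∀
  collect : ∀ M w c → M * (w * + 2) + c * + 2 ≡ (M * w + c) * + 2
  collect = solve-∀

form : ℕ → ℕ → ℤ → ℤ → ℤ
form f g x y = + f * (x * x) + + g * (y * y)

i*i≡+∣i∣*∣i∣ : ∀ i → i * i ≡ + (∣ i ∣ ℕ.* ∣ i ∣)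
i*i≡+∣i∣*∣i∣ (+ n)    = sym (ℤₚ.pos-* n n)
i*i≡+∣i∣*∣i∣ -[1+ n ] = refl

form≡+ : ∀ f g x y → form f g x y ≡ + (f ℕ.* (∣ x ∣ ℕ.* ∣ x ∣) ℕ.+ g ℕ.* (∣ y ∣ ℕ.* ∣ y ∣))
form≡+ f g x y = begin
  + f * (x * x) + + g * (y * y)
    ≡⟨ cong₂ (λ u v → + f * u + + g * v) (i*i≡+∣i∣*∣i∣ x) (i*i≡+∣i∣*∣i∣ y) ⟩
  + f * + (∣ x ∣ ℕ.* ∣ x ∣) + + g * + (∣ y ∣ ℕ.* ∣ y ∣)
    ≡⟨ cong₂ _+_ (sym (ℤₚ.pos-* f _)) (sym (ℤₚ.pos-* g _)) ⟩
  + (f ℕ.* (∣ x ∣ ℕ.* ∣ x ∣)) + + (g ℕ.* (∣ y ∣ ℕ.* ∣ y ∣))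
    ≡⟨ sym (ℤₚ.pos-+ (f ℕ.* (∣ x ∣ ℕ.* ∣ x ∣)) _) ⟩
  + (f ℕ.* (∣ x ∣ ℕ.* ∣ x ∣) ℕ.+ g ℕ.* (∣ y ∣ ℕ.* ∣ y ∣)) ∎
  where open ≡-Reasoning

form≡+∣form∣ : ∀ f g x y → form f g x y ≡ + ∣ form f g x y ∣
form≡+∣form∣ f g x y = subst (λ z → z ≡ + ∣ z ∣) (sym (form≡+ f g x y)) refl

∣⇒≡0 : ∀ {p u z v} → 2 ≤ z → u ℕ.+ z ℕ.* (v ℕ.* v) ≡ p ℕ.* p → p ∣ v → v ≡ 0
∣⇒≡0 {v = ℕ.zero}  _   _  _   = refl
∣⇒≡0 {p} {u} {z} {v@(ℕ.suc _)} 2≤z eq p∣v = ⊥-elim (ℕₚ.<-irrefl refl (begin-strict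
  v²             <⟨ ℕₚ.m<m*n v² 2 (ℕ.s≤s (ℕ.s≤s ℕ.z≤n)) ⟩
  v² ℕ.* 2       ≡⟨ ℕₚ.*-comm v² 2 ⟩
  2 ℕ.* v²       ≤⟨ ℕₚ.*-monoˡ-≤ v² 2≤z ⟩
  z ℕ.* v²       ≤⟨ ℕₚ.m≤n+m _ u ⟩
  u ℕ.+ z ℕ.* v² ≡⟨ eq ⟩
  p ℕ.* p        ≤⟨ ℕₚ.*-mono-≤ p≤v p≤v ⟩
  v²             ∎))
  where
  open ℕₚ.≤-Reasoning
  v² = v ℕ.* v
  p≤v = ∣⇒≤ p∣v

form-∣⇒≡0 : ∀ {p} f z q v → 2 ≤ z → form f z q v ≡ + (p ℕ.* p) → p ∣ ∣ v ∣ → v ≡ 0ℤ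
form-∣⇒≡0 f z q v 2≤z eq p∣v =
  ℤₚ.∣i∣≡0⇒i≡0 (∣⇒≡0 2≤z (ℤₚ.+-injective (trans (sym (form≡+ f z q v)) eq)) p∣v)

brahmagupta⁻ : ∀ f g x y x' y' →
  form 1 (f ℕ.* g) (+ f * x * x' + + g * y * y') (x * y' - x' * y) ≡ form f g x y * form f g x' y'
brahmagupta⁻ f g x y x' y' =
  trans (cong (λ h → + 1 * (Q * Q) + h * ((x * y' - x' * y) * (x * y' - x' * y))) (ℤₚ.pos-* f g))
        (identity (+ f) (+ g) x y x' y')
  where
  Q = + f * x * x' + + g * y * y'
  identity : ∀ F G x y x' y' →
    + 1 * ((F * x * x' + G * y * y') * (F * x * x' + G * y * y'))
      + F * G * ((x * y' - x' * y) * (x * y' - x' * y))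
    ≡ (F * (x * x) + G * (y * y)) * (F * (x' * x') + G * (y' * y'))
  identity = solve-∀

brahmagupta⁺ : ∀ f g x y x' y' →
  form 1 (f ℕ.* g) (+ f * x * x' - + g * y * y') (x * y' + x' * y) ≡ form f g x y * form f g x' y'
brahmagupta⁺ f g x y x' y' =
  trans (cong (λ h → + 1 * (Q * Q) + h * ((x * y' + x' * y) * (x * y' + x' * y))) (ℤₚ.pos-* f g))
        (identity (+ f) (+ g) x y x' y')
  where
  Q = + f * x * x' - + g * y * y'
  identity : ∀ F G x y x' y' →
    + 1 * ((F * x * x' - G * y * y') * (F * x * x' - G * y * y'))
      + F * G * ((x * y' + x' * y) * (x * y' + x' * y))
    ≡ (F * (x * x) + G * (y * y)) * (F * (x' * x') + G * (y' * y'))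
  identity = solve-∀

prime-form-cross≡0 : ∀ {f g p} x y x' y' → Prime p → f ℕ.< p → 2 ≤ f ℕ.* g →
  form f g x y ≡ + p → form f g x' y' ≡ + p →
  (x * y' - x' * y) * (x * y' + x' * y) ≡ 0ℤ
prime-form-cross≡0 {f} {g} {p} x y x' y' prime-p f<p 2≤fg rep rep' =
  [ (λ p∣f → ⊥-elim (p∤f p∣f))
  , (λ p∣AB → [ p∣A⇒AB≡0 , p∣B⇒AB≡0 ] (euclidsLemma ∣ A ∣ ∣ B ∣ prime-p p∣AB))
  ] (euclidsLemma f (∣ A ∣ ℕ.* ∣ B ∣) prime-p p∣f*AB)
  where
  open ≡-Reasoning
  A = x * y' - x' * y
  B = x * y' + x' * y

  p∤f : ¬ p ∣ f
  p∤f p∣f = ℕₚ.<⇒≱ f<p (∣⇒≤ {{ℕₚ.m*n≢0⇒m≢0 f {{fg≢0}}}} p∣f)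
    where fg≢0 = ℕ.>-nonZero (ℕₚ.≤-trans (ℕₚ.n≤1+n 1) 2≤fg)

  f*AB≡p*[y'²-y²] : + f * (A * B) ≡ + p * (y' * y' - y * y)
  f*AB≡p*[y'²-y²] = begin
    + f * (A * B)
      ≡⟨ cross (+ f) (+ g) x y x' y' ⟩
    form f g x y * (y' * y') - form f g x' y' * (y * y)
      ≡⟨ cong₂ (λ u v → u * (y' * y') - v * (y * y)) rep rep' ⟩
    + p * (y' * y') - + p * (y * y)
      ≡⟨ factor (+ p) (y' * y') (y * y) ⟩
    + p * (y' * y' - y * y) ∎
    where
    cross : ∀ F G x y x' y' →
      F * ((x * y' - x' * y) * (x * y' + x' * y))
      ≡ (F * (x * x) + G * (y * y)) * (y' * y') - (F * (x' * x') + G * (y' * y')) * (y * y)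
    cross = solve-∀
    factor : ∀ P u v → P * u - P * v ≡ P * (u - v)
    factor = solve-∀

  p∣f*AB : p ∣ f ℕ.* (∣ A ∣ ℕ.* ∣ B ∣)
  p∣f*AB = subst (p ∣_) ∣p*[y'²-y²]∣≡ (m∣m*n _)
    where
    ∣p*[y'²-y²]∣≡ : p ℕ.* ∣ y' * y' - y * y ∣ ≡ f ℕ.* (∣ A ∣ ℕ.* ∣ B ∣)
    ∣p*[y'²-y²]∣≡ = begin
      p ℕ.* ∣ y' * y' - y * y ∣ ≡⟨ ℤₚ.abs-* (+ p) _ ⟨
      ∣ + p * (y' * y' - y * y) ∣ ≡⟨ cong ∣_∣ f*AB≡p*[y'²-y²] ⟨
      ∣ + f * (A * B) ∣          ≡⟨ ℤₚ.abs-* (+ f) (A * B) ⟩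
      f ℕ.* ∣ A * B ∣            ≡⟨ cong (f ℕ.*_) (ℤₚ.abs-* A B) ⟩
      f ℕ.* (∣ A ∣ ℕ.* ∣ B ∣)    ∎

  vanishes : ∀ q v → form 1 (f ℕ.* g) q v ≡ form f g x y * form f g x' y' → p ∣ ∣ v ∣ → v ≡ 0ℤ
  vanishes q v eq =
    form-∣⇒≡0 1 (f ℕ.* g) q v 2≤fg (trans eq (trans (cong₂ _*_ rep rep') (sym (ℤₚ.pos-* p p))))

  p∣A⇒AB≡0 : p ∣ ∣ A ∣ → A * B ≡ 0ℤ
  p∣A⇒AB≡0 p∣A = begin
    A * B  ≡⟨ cong (_* B) (vanishes (+ f * x * x' + + g * y * y') A (brahmagupta⁻ f g x y x' y') p∣A) ⟩
    0ℤ * B ≡⟨ ℤₚ.*-zeroˡ B ⟩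
    0ℤ     ∎

  p∣B⇒AB≡0 : p ∣ ∣ B ∣ → A * B ≡ 0ℤ
  p∣B⇒AB≡0 p∣B = begin
    A * B  ≡⟨ cong (A *_) (vanishes (+ f * x * x' - + g * y * y') B (brahmagupta⁺ f g x y x' y') p∣B) ⟩
    A * 0ℤ ≡⟨ ℤₚ.*-zeroʳ A ⟩
    0ℤ     ∎

prime-form-rep-unique : ∀ {f g p} x y x' y' → Prime p → f ℕ.< p → 2 ≤ f ℕ.* g →
  form f g x y ≡ + p → form f g x' y' ≡ + p → x * x ≡ x' * x'
prime-form-rep-unique {f} {g} {p} x y x' y' prime-p f<p 2≤fg rep rep' =
  ℤₚ.i-j≡0⇒i≡j _ _ (ℤₚ.*-cancelʳ-≡ _ 0ℤ (+ p) {{prime⇒nonZero prime-p}} (begin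
    (x * x - x' * x') * + p
      ≡⟨ distrib (x * x) (x' * x') (+ p) ⟩
    x * x * + p - x' * x' * + p
      ≡⟨ cong₂ (λ u v → x * x * u - x' * x' * v) rep' rep ⟨
    x * x * form f g x' y' - x' * x' * form f g x y
      ≡⟨ cross (+ f) (+ g) x y x' y' ⟩
    + g * ((x * y' - x' * y) * (x * y' + x' * y))
      ≡⟨ cong (+ g *_) (prime-form-cross≡0 x y x' y' prime-p f<p 2≤fg rep rep') ⟩
    + g * 0ℤ
      ≡⟨ ℤₚ.*-zeroʳ (+ g) ⟩
    0ℤ
      ≡⟨ ℤₚ.*-zeroˡ (+ p) ⟨
    0ℤ * + p ∎))
  where
  open ≡-Reasoning
  distrib : ∀ u v P → (u - v) * P ≡ u * P - v * P
  distrib = solve-∀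
  cross : ∀ F G x y x' y' →
    x * x * (F * (x' * x') + G * (y' * y')) - x' * x' * (F * (x * x) + G * (y * y))
    ≡ G * ((x * y' - x' * y) * (x * y' + x' * y))
  cross = solve-∀

[a+b]²≡[a-b]²⇒ab≡0 : ∀ a b → (a + b) * (a + b) ≡ (a - b) * (a - b) → a * b ≡ 0ℤ
[a+b]²≡[a-b]²⇒ab≡0 a b eq = ℤₚ.*-cancelˡ-≡ (+ 4) (a * b) 0ℤ (begin
  + 4 * (a * b)                             ≡⟨ expand a b ⟩
  (a + b) * (a + b) - (a - b) * (a - b)     ≡⟨ ℤₚ.i≡j⇒i-j≡0 eq ⟩
  0ℤ                                        ∎)
  where
  open ≡-Reasoning
  expand : ∀ a b → + 4 * (a * b) ≡ (a + b) * (a + b) - (a - b) * (a - b)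
  expand = solve-∀

4ab≡tc[fc-2d]⇒¬Prime : ∀ f t a b c d → 2 ≤ f → 1 ≤ t → a > 0 → b > 0 →
  + 4 * (+ a * + b) ≡ + t * (c * (+ f * c - + 2 * d)) →
  ¬ Prime ∣ form f t (+ a + + b) d ∣
4ab≡tc[fc-2d]⇒¬Prime f t a b c d 2≤f 1≤t a>0 b>0 rel prime-p =
  ℕₚ.<⇒≢ (ℕₚ.*-mono-< a>0 b>0) (sym ab≡0)
  where
  x = + a + + b
  x' = + a - + b
  y' = + f * c - d
  p = ∣ form f t x d ∣
  f≢0 = ℕ.>-nonZero (ℕₚ.≤-trans (ℕₚ.n≤1+n 1) 2≤f)

  rep : form f t x d ≡ + p
  rep = form≡+∣form∣ f t x d

  rep' : form f t x' y' ≡ + p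
  rep' = trans (ℤₚ.i-j≡0⇒i≡j _ _ (begin
    form f t x' y' - form f t x d                 ≡⟨ shift (+ f) (+ t) (+ a) (+ b) c d ⟩
    + f * (+ t * (c * (+ f * c - + 2 * d)) - 4ab) ≡⟨ cong (λ z → + f * (z - 4ab)) rel ⟨
    + f * (4ab - 4ab)                             ≡⟨ cong (+ f *_) (ℤₚ.+-inverseʳ 4ab) ⟩
    + f * 0ℤ                                      ≡⟨ ℤₚ.*-zeroʳ (+ f) ⟩
    0ℤ                                            ∎)) rep
    where
    open ≡-Reasoning
    4ab = + 4 * (+ a * + b)
    shift : ∀ F T a b c d →
      F * ((a - b) * (a - b)) + T * ((F * c - d) * (F * c - d)) - (F * ((a + b) * (a + b)) + T * (d * d))
      ≡ F * (T * (c * (F * c - + 2 * d)) - + 4 * (a * b))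
    shift = solve-∀

  f<p : f ℕ.< p
  f<p = begin-strict
    f                                          <⟨ ℕₚ.m<m*n f (n ℕ.* n) {{f≢0}} 1<n² ⟩
    f ℕ.* (n ℕ.* n)                            ≤⟨ ℕₚ.m≤m+n _ _ ⟩
    f ℕ.* (n ℕ.* n) ℕ.+ t ℕ.* (∣ d ∣ ℕ.* ∣ d ∣) ≡⟨ cong ∣_∣ (form≡+ f t x d) ⟨
    p                                          ∎
    where
    open ℕₚ.≤-Reasoning
    n = a ℕ.+ b
    2≤n = ℕₚ.+-mono-≤ a>0 b>0
    1<n² = ℕₚ.<-≤-trans (ℕ.s≤s (ℕ.s≤s ℕ.z≤n)) (ℕₚ.*-mono-≤ 2≤n 2≤n)

  ab≡0 : a ℕ.* b ≡ 0
  ab≡0 = ℤₚ.+-injective (trans (ℤₚ.pos-* a b) ([a+b]²≡[a-b]²⇒ab≡0 (+ a) (+ b)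
    (prime-form-rep-unique x d x' y' prime-p f<p (ℕₚ.*-mono-≤ 2≤f 1≤t) rep rep')))

ab≡tP⇒4ab≡tc[fc-2d] : ∀ m t a b c → + a * + b ≡ + t * P m c →
  + 4 * (+ a * + b) ≡ + t * (c * (+ 2 * (+ m - + 2) * c - + 2 * (+ m - + 4)))
ab≡tP⇒4ab≡tc[fc-2d] m t a b c ab≡tP = begin
  + 4 * (+ a * + b)                                       ≡⟨ cong (+ 4 *_) ab≡tP ⟩
  + 4 * (+ t * P m c)                                     ≡⟨ regroup (+ t) (P m c) ⟩
  + 2 * + t * (+ 2 * P m c)                               ≡⟨ cong (+ 2 * + t *_) (2*P≡ m c) ⟩
  + 2 * + t * (c * ((+ m - + 2) * c - (+ m - + 4)))       ≡⟨ double (+ t) c (+ m) ⟩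
  + t * (c * (+ 2 * (+ m - + 2) * c - + 2 * (+ m - + 4))) ∎
  where
  open ≡-Reasoning
  regroup : ∀ T Q → + 4 * (T * Q) ≡ + 2 * T * (+ 2 * Q)
  regroup = solve-∀
  double : ∀ T c X →
    + 2 * T * (c * ((X - + 2) * c - (X - + 4))) ≡ T * (c * (+ 2 * (X - + 2) * c - + 2 * (X - + 4)))
  double = solve-∀

theorem1 : (m n t : ℕ) → 3 ≤ m → 1 ≤ n → 1 ≤ t →
    Prime ∣ + 2 * (+ m - + 2) * (+ n * + n) + + t * ((+ m - + 4) * (+ m - + 4)) ∣ →
    ¬ (Σ ℕ λ a → Σ ℕ λ b → Σ ℤ λ c →
         a > 0 × b > 0 × (m ≤ 4 → c >ℤ + 0) ×
         a +ℕ b ≡ n × + a * + b ≡ + t * P m c)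
theorem1 m .(a +ℕ b) t 3≤m _ 1≤t prime-E (a , b , c , a>0 , b>0 , _ , refl , ab≡tP) =
  4ab≡tc[fc-2d]⇒¬Prime f t a b c d 2≤f 1≤t a>0 b>0
    (subst (λ F → + 4 * (+ a * + b) ≡ + t * (c * (F * c - + 2 * d))) 2[m-2]≡f
      (ab≡tP⇒4ab≡tc[fc-2d] m t a b c ab≡tP))
    (subst (λ F → Prime ∣ F * (+ (a +ℕ b) * + (a +ℕ b)) + + t * (d * d) ∣) 2[m-2]≡f prime-E)
  where
  f = 2 ℕ.* (m ℕ.∸ 2)
  d = + m - + 4
  2≤f : 2 ≤ f
  2≤f = ℕₚ.*-monoʳ-≤ 2 (ℕₚ.∸-monoˡ-≤ 2 3≤m)
  2[m-2]≡f : + 2 * (+ m - + 2) ≡ + f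
  2[m-2]≡f = trans (cong (+ 2 *_) (trans (ℤₚ.m-n≡m⊖n m 2) (ℤₚ.⊖-≥ (ℕₚ.≤-trans (ℕₚ.n≤1+n 2) 3≤m))))
                   (sym (ℤₚ.pos-* 2 (m ℕ.∸ 2)))
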